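{- Let $D>1$ be squarefree, $\mathcal{O}$ the ring of integers of $\mathbb{Q}(\sqrt D)$, $\Gamma_{\mathcal O}=\{(\gamma,\gamma^\sigma):\gamma\in\mathrm{PSL}_2(\mathcal{O})\}$ and $\Gamma=\{(\gamma,\gamma^\sigma):\gamma\in M/\{\pm\mathrm{Id}\}\}$ with $M=\{\begin{pmatrix}a&b\\c&d\end{pmatrix}\in\mathrm{SL}_2(\mathcal{O}):a+d,\ b+c\in2\mathcal{O}\}$. Then \[ [\Gamma_{\mathcal O}:\Gamma]=6-3\chi(2)+6\chi(4). \]
   Context: $\gamma^\sigma$ is entrywise Galois conjugation ($\sqrt D\mapsto-\sqrt D$). $\Delta$ is the discriminant of $\mathbb{Q}(\sqrt D)$ ($\Delta=D$ if $D\equiv1\pmod4$, $\Delta=4D$ otherwise) and $\chi(n)=\left(\frac{\Delta}{n}\right)$ is the Kronecker symbol. -}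

module Defs where

open import Data.Bool using (Bool; true; false; if_then_else_)
open import Data.Nat as ℕ using (ℕ; _≡ᵇ_)
open import Data.Nat.DivMod using (_%_; _/_)
open import Data.Integer as ℤ using (ℤ; +_; -_; _+_; _*_; _-_)
open import Data.Integer.Divisibility using (_∣_)
open import Data.Product using (_×_; _,_; Σ; ∃)
open import Data.Sum using (_⊎_)
open import Relation.Binary.PropositionalEquality using (_≡_)

SquareFree : ℕ → Set
SquareFree D = ∀ (n : ℕ) → (n ℕ.* n) Data.Nat.Divisibility.∣ D → n ≡ 1
  where import Data.Nat.Divisibility

oneMod4 : ℕ → Bool
oneMod4 D = (D % 4) ≡ᵇ 1

-- Ring of integers O of Q(√D): elements x + y·ω with x y ∈ ℤ, where
-- ω = (1+√D)/2 if D ≡ 1 (mod 4) and ω = √D otherwise.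
O : Set
O = ℤ × ℤ

-- ω² = p + q·ω
ωsq : ℕ → ℤ × ℤ
ωsq D = if oneMod4 D then (+ ((D ℕ.∸ 1) / 4) , + 1) else (+ D , + 0)

0O 1O : O
0O = (+ 0 , + 0)
1O = (+ 1 , + 0)

addO : O → O → O
addO (a , b) (c , d) = (a + c , b + d)

negO : O → O
negO (a , b) = (- a , - b)

subO : O → O → O
subO x y = addO x (negO y)

mulO : ℕ → O → O → O
mulO D (a , b) (c , d) with ωsq D
... | (p , q) = (a * c + b * d * p , a * d + b * c + b * d * q)

-- Galois conjugation √D ↦ -√D.
-- If ω = √D: σ(x + yω) = x - yω.  If ω = (1+√D)/2: σ(ω) = 1 - ω.
σO : ℕ → O → O
σO D (x , y) = if oneMod4 D then (x + y , - y) else (x , - y)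

In2O : O → Set
In2O (x , y) = (+ 2 ∣ x) × (+ 2 ∣ y)

record Mat : Set where
  constructor mat
  field
    a b c d : O
open Mat public

det : ℕ → Mat → O
det D m = subO (mulO D (a m) (d m)) (mulO D (b m) (c m))

InSL2 : ℕ → Mat → Set
InSL2 D m = det D m ≡ 1O

mulM : ℕ → Mat → Mat → Mat
mulM D (mat a₁ b₁ c₁ d₁) (mat a₂ b₂ c₂ d₂) =
  mat (addO (mulO D a₁ a₂) (mulO D b₁ c₂)) (addO (mulO D a₁ b₂) (mulO D b₁ d₂))
      (addO (mulO D c₁ a₂) (mulO D d₁ c₂)) (addO (mulO D c₁ b₂) (mulO D d₁ d₂))

-- inverse of a determinant-one matrix
invM : Mat → Mat
invM (mat a b c d) = mat d (negO b) (negO c) a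

negM : Mat → Mat
negM (mat a b c d) = mat (negO a) (negO b) (negO c) (negO d)

σM : ℕ → Mat → Mat
σM D (mat a b c d) = mat (σO D a) (σO D b) (σO D c) (σO D d)

InM : ℕ → Mat → Set
InM D m = InSL2 D m × In2O (addO (a m) (d m)) × In2O (addO (b m) (c m))

-- Equality in PSL₂: equal up to sign.
_≈±_ : Mat → Mat → Set
g ≈± h = (g ≡ h) ⊎ (g ≡ negM h)

-- Elements of Γ_O are pairs (γ, γ^σ) ∈ PSL₂(ℝ)×PSL₂(ℝ), γ ∈ SL₂(O).
-- Left-coset relation in Γ_O w.r.t. Γ:  x Γ = y Γ  iff  x⁻¹ y ∈ Γ, i.e.
-- (γ⁻¹δ, (γ⁻¹δ)^σ) = (m, m^σ) in PSL₂×PSL₂ for some m ∈ M.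
SameCoset : ℕ → Mat → Mat → Set
SameCoset D γ δ = Σ Mat λ m → InM D m
  × (mulM D (invM γ) δ ≈± m)
  × (σM D (mulM D (invM γ) δ) ≈± σM D m)

-- [Γ_O : Γ] = N : there are N elements of Γ_O representing pairwise
-- distinct left cosets of Γ and covering Γ_O.
open import Data.Fin using (Fin)
IndexIs : ℕ → ℕ → Set
IndexIs D N = Σ (Fin N → Mat) λ r →
    (∀ i → InSL2 D (r i))
  × (∀ γ → InSL2 D γ → ∃ λ i → SameCoset D (r i) γ)
  × (∀ i j → SameCoset D (r i) (r j) → i ≡ j)

disc : ℕ → ℕ
disc D = if oneMod4 D then D else 4 ℕ.* D

kron2 : ℕ → ℤ
kron2 Δ with Δ % 8
... | 1 = + 1
... | 7 = + 1
... | 3 = - (+ 1)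
... | 5 = - (+ 1)
... | _ = + 0

-- χ(n) = (Δ/n) for n = 2, 4; the Kronecker symbol is defined multiplicatively
-- in the prime factorisation of n, so (Δ/4) = (Δ/2)².
χ2 χ4 : ℕ → ℤ
χ2 D = kron2 (disc D)
χ4 D = χ2 D * χ2 D

module Submission where

-- Whether γ⁻¹δ lies in M (up to sign) only depends on γ⁻¹δ modulo 2O:
-- M asks for a ≡ d and b ≡ c mod 2, and ±1 agree mod 2.  So cosets of Γ
-- in Γ_O are cosets of the image of M in SL₂(O/2O), and O/2O only depends
-- on the class (p̄, q̄) of ω² mod 2.  Sections: (1) parity is a ring
-- homomorphism ℤ → 𝔽₂ detecting 2ℤ; (2) ℤ[ω] is a commutative ring, so
-- det is multiplicative; (3) reduction mod 2 of O and of matrices is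
-- multiplicative; (4) M is the preimage of the matrices (a b; b a);
-- (5-6) lifted products E(x)F(y) of elementary matrices are coset
-- representatives once two finite statements over SL₂(O/2O) hold;
-- (7) for each class these are decided by evaluation, giving index
-- 6, 9 or 15; (8) χ(2) is 0, 1 or -1 on the same classes; (9) the
-- formula.  D > 1 squarefree only makes O the full ring of integers;
-- the count holds for every D.

open import Defs
open import Data.Nat using (ℕ; _<_)
open import Data.Integer using (+_; _+_; _-_; _*_)
open import Relation.Binary.PropositionalEquality using (_≡_)
open import Data.Product using (Σ; _×_)

open import Data.Nat as ℕ using (zero; suc; parity)
import Data.Nat.Properties as ℕP
import Data.Nat.Divisibility as ℕ∣
open import Data.Nat.DivMod using (_/_; _%_; m≡m%n+[m/n]*n; m*n/n≡m)
open import Data.Integer using (ℤ; -[1+_]; -_; ∣_∣; _⊖_)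
import Data.Integer.Properties as ℤP
open import Data.Integer.Divisibility using (_∣_; divides)
open import Data.Integer.Tactic.RingSolver using (solve-∀)
open import Data.Parity as ℙ using (Parity; 0ℙ; 1ℙ)
import Data.Parity.Properties as ℙP
open import Data.Product using (_,_; proj₁; proj₂; ∃)
open import Data.Product.Properties using (≡-dec)
open import Data.Sum using (inj₁; inj₂)
open import Data.Bool using (true; false; T)
open import Data.Unit using (tt)
open import Data.Maybe using (Maybe; just; nothing)
open import Data.Fin using (Fin)
open import Data.Fin.Properties as Fin using (all?; any?)
open import Data.Vec using ([]; _∷_; lookup)
open import Algebra.Bundles using (CommutativeRing)
open import Algebra.Structures using (IsCommutativeRing)
open import Algebra.Consequences.Propositional
  using (comm∧idˡ⇒id; comm∧invˡ⇒inv; comm∧distrˡ⇒distrʳ)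
import Tactic.RingSolver.Core.AlmostCommutativeRing as ACR
open import Relation.Binary.Definitions using (DecidableEquality)
open import Relation.Nullary.Decidable
  using (Dec; yes; no; map′; _×-dec_; _→-dec_; True; toWitness)
open import Relation.Binary.PropositionalEquality
  using (refl; sym; trans; cong; cong₂; subst; isEquivalence; module ≡-Reasoning)

-- 1. Parity of integers

parityℤ : ℤ → Parity
parityℤ x = parity ∣ x ∣

parity-∣⊖∣ : ∀ m n → parity ∣ m ⊖ n ∣ ≡ parity (m ℕ.+ n)
parity-∣⊖∣ m       zero    = cong parity (sym (ℕP.+-identityʳ m))
parity-∣⊖∣ zero    (suc n) = refl
parity-∣⊖∣ (suc m) (suc n) = begin
  parity ∣ suc m ⊖ suc n ∣  ≡⟨ cong (λ z → parity ∣ z ∣) (ℤP.[1+m]⊖[1+n]≡m⊖n m n) ⟩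
  parity ∣ m ⊖ n ∣          ≡⟨ parity-∣⊖∣ m n ⟩
  parity (m ℕ.+ n)          ≡⟨ cong (λ z → parity (suc z)) (ℕP.+-suc m n) ⟨
  parity (suc m ℕ.+ suc n)  ∎
  where open ≡-Reasoning

parityℤ-+ : ∀ x y → parityℤ (x + y) ≡ parityℤ x ℙ.+ parityℤ y
parityℤ-+ (+ m)    (+ n)    = ℙP.+-homo-+ m n
parityℤ-+ (+ m)    -[1+ n ] = trans (parity-∣⊖∣ m (suc n)) (ℙP.+-homo-+ m (suc n))
parityℤ-+ -[1+ m ] (+ n)    =
  trans (parity-∣⊖∣ n (suc m)) (trans (ℙP.+-homo-+ n (suc m)) (ℙP.+-comm (parity n) _))
parityℤ-+ -[1+ m ] -[1+ n ] =
  trans (cong (λ z → parity (suc z)) (sym (ℕP.+-suc m n))) (ℙP.+-homo-+ (suc m) (suc n))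

parityℤ-* : ∀ x y → parityℤ (x * y) ≡ parityℤ x ℙ.* parityℤ y
parityℤ-* x y = trans (cong parity (ℤP.abs-* x y)) (ℙP.*-homo-* ∣ x ∣ ∣ y ∣)

parityℤ-neg : ∀ x → parityℤ (- x) ≡ parityℤ x
parityℤ-neg x = cong parity (ℤP.∣-i∣≡∣i∣ x)

even⇒2∣ : ∀ n → parity n ≡ 0ℙ → 2 ℕ∣.∣ n
even⇒2∣ zero          _  = 2 ℕ∣.∣0
even⇒2∣ (suc zero)    ()
even⇒2∣ (suc (suc n)) e  = ℕ∣.∣m∣n⇒∣m+n (ℕ∣.∣-refl {2}) (even⇒2∣ n e)

+-zero⇒≡ : ∀ x y → x ℙ.+ y ≡ 0ℙ → x ≡ y
+-zero⇒≡ 0ℙ 0ℙ _ = refl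
+-zero⇒≡ 1ℙ 1ℙ _ = refl

2∣+⇒same-parity : ∀ u v → + 2 ∣ u + v → parityℤ u ≡ parityℤ v
2∣+⇒same-parity u v (divides k eq) = +-zero⇒≡ (parityℤ u) (parityℤ v) (begin
  parityℤ u ℙ.+ parityℤ v  ≡⟨ parityℤ-+ u v ⟨
  parity ∣ u + v ∣         ≡⟨ cong parity eq ⟩
  parity (k ℕ.* 2)         ≡⟨ ℙP.*-homo-* k 2 ⟩
  parity k ℙ.* 0ℙ          ≡⟨ ℙP.*-zeroʳ (parity k) ⟩
  0ℙ                       ∎)
  where open ≡-Reasoning

same-parity⇒2∣+ : ∀ u v → parityℤ u ≡ parityℤ v → + 2 ∣ u + v
same-parity⇒2∣+ u v e = even⇒2∣ ∣ u + v ∣ (begin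
  parityℤ (u + v)          ≡⟨ parityℤ-+ u v ⟩
  parityℤ u ℙ.+ parityℤ v  ≡⟨ cong (parityℤ u ℙ.+_) (sym e) ⟩
  parityℤ u ℙ.+ parityℤ u  ≡⟨ ℙP.p+p≡0ℙ (parityℤ u) ⟩
  0ℙ                       ∎)
  where open ≡-Reasoning

-- 2. The ring ℤ[ω] with ω² = p + qω, and determinants over it

-- The polynomial identities behind the multiplicative laws of ℤ[ω];
-- each is one coordinate (in the basis 1, ω) of a law.
·-comm₁ : ∀ p q a b c d → a * c + b * d * p ≡ c * a + d * b * p
·-comm₁ = solve-∀

·-comm₂ : ∀ p q a b c d → a * d + b * c + b * d * q ≡ c * b + d * a + d * b * q
·-comm₂ = solve-∀

·-assoc₁ : ∀ p q a b c d e f →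
  (a * c + b * d * p) * e + (a * d + b * c + b * d * q) * f * p
    ≡ a * (c * e + d * f * p) + b * (c * f + d * e + d * f * q) * p
·-assoc₁ = solve-∀

·-assoc₂ : ∀ p q a b c d e f →
  (a * c + b * d * p) * f + (a * d + b * c + b * d * q) * e
      + (a * d + b * c + b * d * q) * f * q
    ≡ a * (c * f + d * e + d * f * q) + b * (c * e + d * f * p)
      + b * (c * f + d * e + d * f * q) * q
·-assoc₂ = solve-∀

·-distrib₁ : ∀ p q a b c d e f →
  a * (c + e) + b * (d + f) * p ≡ (a * c + b * d * p) + (a * e + b * f * p)
·-distrib₁ = solve-∀

·-distrib₂ : ∀ p q a b c d e f →
  a * (d + f) + b * (c + e) + b * (d + f) * q
    ≡ (a * d + b * c + b * d * q) + (a * f + b * e + b * f * q)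
·-distrib₂ = solve-∀

·-identity₁ : ∀ p q a b → + 1 * a + + 0 * b * p ≡ a
·-identity₁ = solve-∀

·-identity₂ : ∀ p q a b → + 1 * b + + 0 * a + + 0 * b * q ≡ b
·-identity₂ = solve-∀

module QuadraticRing (p q : ℤ) where

  -- Multiplication in ℤ[ω] = ℤ × ℤ; it is the multiplication mulO of Defs.
  infixl 7 _·_
  _·_ : O → O → O
  (a , b) · (c , d) = (a * c + b * d * p , a * d + b * c + b * d * q)

  ·-comm : ∀ x y → x · y ≡ y · x
  ·-comm (a , b) (c , d) = cong₂ _,_ (·-comm₁ p q a b c d) (·-comm₂ p q a b c d)

  ·-assoc : ∀ x y z → (x · y) · z ≡ x · (y · z)
  ·-assoc (a , b) (c , d) (e , f) =
    cong₂ _,_ (·-assoc₁ p q a b c d e f) (·-assoc₂ p q a b c d e f)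

  ·-distribˡ : ∀ x y z → x · addO y z ≡ addO (x · y) (x · z)
  ·-distribˡ (a , b) (c , d) (e , f) =
    cong₂ _,_ (·-distrib₁ p q a b c d e f) (·-distrib₂ p q a b c d e f)

  ·-identityˡ : ∀ x → 1O · x ≡ x
  ·-identityˡ (a , b) = cong₂ _,_ (·-identity₁ p q a b) (·-identity₂ p q a b)

  addO-comm : ∀ x y → addO x y ≡ addO y x
  addO-comm (a , b) (c , d) = cong₂ _,_ (ℤP.+-comm a c) (ℤP.+-comm b d)

  -- ℤ[ω] is a commutative ring; this lets the ring solver prove the
  -- determinant identities below.
  isCommutativeRing : IsCommutativeRing _≡_ addO _·_ negO 0O 1O
  isCommutativeRing = record
    { isRing = record
      { +-isAbelianGroup = record
        { isGroup = record
          { isMonoid = record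
            { isSemigroup = record
              { isMagma = record { isEquivalence = isEquivalence ; ∙-cong = cong₂ addO }
              ; assoc = λ (a , b) (c , d) (e , f) →
                  cong₂ _,_ (ℤP.+-assoc a c e) (ℤP.+-assoc b d f)
              }
            ; identity = comm∧idˡ⇒id addO-comm λ (a , b) →
                cong₂ _,_ (ℤP.+-identityˡ a) (ℤP.+-identityˡ b)
            }
          ; inverse = comm∧invˡ⇒inv addO-comm λ (a , b) →
              cong₂ _,_ (ℤP.+-inverseˡ a) (ℤP.+-inverseˡ b)
          ; ⁻¹-cong = cong negO
          }
        ; comm = addO-comm
        }
      ; *-cong = cong₂ _·_
      ; *-assoc = ·-assoc
      ; *-identity = comm∧idˡ⇒id ·-comm ·-identityˡ
      ; distrib = ·-distribˡ , comm∧distrˡ⇒distrʳ ·-comm ·-distribˡ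
      }
    ; *-comm = ·-comm
    }

  commutativeRing : CommutativeRing _ _
  commutativeRing = record { isCommutativeRing = isCommutativeRing }

  -- Zero test on coefficients, which the ring solver needs to cancel terms.
  isZero : ∀ x → Maybe (0O ≡ x)
  isZero x with ≡-dec ℤP._≟_ ℤP._≟_ 0O x
  ... | yes e = just e
  ... | no _  = nothing

  open import Tactic.RingSolver.NonReflective
    (ACR.fromCommutativeRing commutativeRing isZero)

  det₂ : O → O → O → O → O
  det₂ a b c d = addO (a · d) (negO (b · c))

  det₂-product : ∀ a b c d a' b' c' d' →
    det₂ (addO (a · a') (b · c')) (addO (a · b') (b · d'))
         (addO (c · a') (d · c')) (addO (c · b') (d · d'))
      ≡ det₂ a b c d · det₂ a' b' c' d'
  det₂-product = solve 8 (λ a b c d a' b' c' d' →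
      (a ⊗ a' ⊕ b ⊗ c') ⊗ (c ⊗ b' ⊕ d ⊗ d') ⊕ ⊝ ((a ⊗ b' ⊕ b ⊗ d') ⊗ (c ⊗ a' ⊕ d ⊗ c'))
        ⊜ (a ⊗ d ⊕ ⊝ (b ⊗ c)) ⊗ (a' ⊗ d' ⊕ ⊝ (b' ⊗ c'))) refl

  det₂-adjugate : ∀ a b c d → det₂ d (negO b) (negO c) a ≡ det₂ a b c d
  det₂-adjugate = solve 4 (λ a b c d →
    d ⊗ a ⊕ ⊝ ((⊝ b) ⊗ (⊝ c)) ⊜ (a ⊗ d ⊕ ⊝ (b ⊗ c))) refl

  det₂-upper : ∀ x → det₂ 1O x 0O 1O ≡ 1O
  det₂-upper = solve 1 (λ x → Κ 1O ⊗ Κ 1O ⊕ ⊝ (x ⊗ Κ 0O) ⊜ Κ 1O) refl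

  det₂-lower : ∀ y → det₂ 1O 0O y 1O ≡ 1O
  det₂-lower = solve 1 (λ y → Κ 1O ⊗ Κ 1O ⊕ ⊝ (Κ 0O ⊗ y) ⊜ Κ 1O) refl

module Order (D : ℕ) = QuadraticRing (proj₁ (ωsq D)) (proj₂ (ωsq D))

det-mul : ∀ D A B → det D (mulM D A B) ≡ mulO D (det D A) (det D B)
det-mul D (mat a b c d) (mat a' b' c' d') = Order.det₂-product D a b c d a' b' c' d'

det-inv : ∀ D A → det D (invM A) ≡ det D A
det-inv D (mat a b c d) = Order.det₂-adjugate D a b c d

-- 3. Reduction modulo 2

-- O/2O = 𝔽₂ × 𝔽₂, coordinates in the basis 1, ω.
F₂² : Set
F₂² = Parity × Parity

_≟₂_ : DecidableEquality F₂²
_≟₂_ = ≡-dec ℙP._≟_ ℙP._≟_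

red : O → F₂²
red (x , y) = (parityℤ x , parityℤ y)

-- The class (p̄ , q̄) of ω² = p + qω modulo 2, which determines O/2O.
ω²mod2 : ℕ → F₂²
ω²mod2 D = red (ωsq D)

0₂ 1₂ ω₂ 1+ω₂ : F₂²
0₂   = (0ℙ , 0ℙ)
1₂   = (1ℙ , 0ℙ)
ω₂   = (0ℙ , 1ℙ)
1+ω₂ = (1ℙ , 1ℙ)

_+₂_ : F₂² → F₂² → F₂²
(a , b) +₂ (c , d) = (a ℙ.+ c , b ℙ.+ d)

mul₂ : F₂² → F₂² → F₂² → F₂²
mul₂ (p̄ , q̄) (a , b) (c , d) =
  ((a ℙ.* c) ℙ.+ (b ℙ.* d ℙ.* p̄) , (a ℙ.* d) ℙ.+ (b ℙ.* c) ℙ.+ (b ℙ.* d ℙ.* q̄))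

red-add : ∀ x y → red (addO x y) ≡ red x +₂ red y
red-add (a , b) (c , d) = cong₂ _,_ (parityℤ-+ a c) (parityℤ-+ b d)

red-neg : ∀ x → red (negO x) ≡ red x
red-neg (a , b) = cong₂ _,_ (parityℤ-neg a) (parityℤ-neg b)

parityℤ-*₃ : ∀ b d p → parityℤ (b * d * p) ≡ parityℤ b ℙ.* parityℤ d ℙ.* parityℤ p
parityℤ-*₃ b d p = trans (parityℤ-* (b * d) p) (cong (ℙ._* parityℤ p) (parityℤ-* b d))

red-mul : ∀ D x y → red (mulO D x y) ≡ mul₂ (ω²mod2 D) (red x) (red y)
red-mul D (a , b) (c , d) = cong₂ _,_
  (trans (parityℤ-+ (a * c) (b * d * p))
    (cong₂ ℙ._+_ (parityℤ-* a c) (parityℤ-*₃ b d p)))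
  (trans (parityℤ-+ (a * d + b * c) (b * d * q))
    (cong₂ ℙ._+_ (trans (parityℤ-+ (a * d) (b * c)) (cong₂ ℙ._+_ (parityℤ-* a d) (parityℤ-* b c)))
                 (parityℤ-*₃ b d q)))
  where p = proj₁ (ωsq D); q = proj₂ (ωsq D)

record Mat₂ : Set where
  constructor mat₂
  field a₂ b₂ c₂ d₂ : F₂²

mulM₂ : F₂² → Mat₂ → Mat₂ → Mat₂
mulM₂ k (mat₂ a b c d) (mat₂ a' b' c' d') =
  mat₂ (mul₂ k a a' +₂ mul₂ k b c') (mul₂ k a b' +₂ mul₂ k b d')
       (mul₂ k c a' +₂ mul₂ k d c') (mul₂ k c b' +₂ mul₂ k d d')

-- Adjugate and determinant; signs disappear modulo 2.
adj₂ : Mat₂ → Mat₂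
adj₂ (mat₂ a b c d) = mat₂ d b c a

detM₂ : F₂² → Mat₂ → F₂²
detM₂ k (mat₂ a b c d) = mul₂ k a d +₂ mul₂ k b c

redM : Mat → Mat₂
redM (mat a b c d) = mat₂ (red a) (red b) (red c) (red d)

mat₂-cong : ∀ {a b c d a' b' c' d'} → a ≡ a' → b ≡ b' → c ≡ c' → d ≡ d' →
  mat₂ a b c d ≡ mat₂ a' b' c' d'
mat₂-cong refl refl refl refl = refl

red-entry : ∀ D x y z w →
  red (addO (mulO D x y) (mulO D z w))
    ≡ mul₂ (ω²mod2 D) (red x) (red y) +₂ mul₂ (ω²mod2 D) (red z) (red w)
red-entry D x y z w =
  trans (red-add (mulO D x y) (mulO D z w)) (cong₂ _+₂_ (red-mul D x y) (red-mul D z w))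

redM-mul : ∀ D A B → redM (mulM D A B) ≡ mulM₂ (ω²mod2 D) (redM A) (redM B)
redM-mul D (mat a b c d) (mat a' b' c' d') =
  mat₂-cong (red-entry D a a' b c') (red-entry D a b' b d')
            (red-entry D c a' d c') (red-entry D c b' d d')

redM-inv : ∀ A → redM (invM A) ≡ adj₂ (redM A)
redM-inv (mat a b c d) = mat₂-cong refl (red-neg b) (red-neg c) refl

redM-neg : ∀ A → redM (negM A) ≡ redM A
redM-neg (mat a b c d) = mat₂-cong (red-neg a) (red-neg b) (red-neg c) (red-neg d)

redM-det : ∀ D A → red (det D A) ≡ detM₂ (ω²mod2 D) (redM A)
redM-det D (mat a b c d) =
  trans (red-add (mulO D a d) (negO (mulO D b c)))
        (cong₂ _+₂_ (red-mul D a d) (trans (red-neg (mulO D b c)) (red-mul D b c)))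

-- 4. M is defined by a congruence modulo 2

-- The image of M in SL₂(O/2O): matrices (a b; b a).
IsM₂ : Mat₂ → Set
IsM₂ (mat₂ a b c d) = (a ≡ d) × (b ≡ c)

isM₂? : ∀ m → Dec (IsM₂ m)
isM₂? (mat₂ a b c d) = (a ≟₂ d) ×-dec (b ≟₂ c)

In2O⇒≡₂ : ∀ x y → In2O (addO x y) → red x ≡ red y
In2O⇒≡₂ (a , b) (c , d) (2∣a+c , 2∣b+d) =
  cong₂ _,_ (2∣+⇒same-parity a c 2∣a+c) (2∣+⇒same-parity b d 2∣b+d)

≡₂⇒In2O : ∀ x y → red x ≡ red y → In2O (addO x y)
≡₂⇒In2O (a , b) (c , d) e =
  same-parity⇒2∣+ a c (cong proj₁ e) , same-parity⇒2∣+ b d (cong proj₂ e)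

InM⇒IsM₂ : ∀ D m → InM D m → IsM₂ (redM m)
InM⇒IsM₂ D (mat a b c d) (_ , a+d∈2O , b+c∈2O) = In2O⇒≡₂ a d a+d∈2O , In2O⇒≡₂ b c b+c∈2O

IsM₂⇒congruences : ∀ m → IsM₂ (redM m) →
  In2O (addO (a m) (d m)) × In2O (addO (b m) (c m))
IsM₂⇒congruences (mat a b c d) (a≡d , b≡c) = ≡₂⇒In2O a d a≡d , ≡₂⇒In2O b c b≡c

-- 5. Coset representatives: products of elementary matrices

E F : O → Mat
E x = mat 1O x 0O 1O
F y = mat 1O 0O y 1O

E₂ F₂ : F₂² → Mat₂
E₂ x = mat₂ 1₂ x 0₂ 1₂
F₂ y = mat₂ 1₂ 0₂ y 1₂

-- A representative E(x)F(y) or F(y)E(x), with x, y lifted from O/2O.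
data Word : Set where
  E·F : F₂² → F₂² → Word
  F·E : F₂² → F₂² → Word

digit : Parity → ℤ
digit 0ℙ = + 0
digit 1ℙ = + 1

lift : F₂² → O
lift (x , y) = (digit x , digit y)

red-lift : ∀ x → red (lift x) ≡ x
red-lift (x , y) = cong₂ _,_ (parity-digit x) (parity-digit y)
  where
  parity-digit : ∀ b → parityℤ (digit b) ≡ b
  parity-digit 0ℙ = refl
  parity-digit 1ℙ = refl

word : ℕ → Word → Mat
word D (E·F x y) = mulM D (E (lift x)) (F (lift y))
word D (F·E y x) = mulM D (F (lift y)) (E (lift x))

word₂ : F₂² → Word → Mat₂
word₂ k (E·F x y) = mulM₂ k (E₂ x) (F₂ y)
word₂ k (F·E y x) = mulM₂ k (F₂ y) (E₂ x)

det-word : ∀ D w → det D (word D w) ≡ 1O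
det-word D (E·F x y) = begin
  det D (mulM D (E (lift x)) (F (lift y)))          ≡⟨ det-mul D (E (lift x)) (F (lift y)) ⟩
  mulO D (det D (E (lift x))) (det D (F (lift y)))  ≡⟨ cong₂ (mulO D) (Order.det₂-upper D (lift x)) (Order.det₂-lower D (lift y)) ⟩
  mulO D 1O 1O                                      ≡⟨ Order.·-identityˡ D 1O ⟩
  1O                                                ∎
  where open ≡-Reasoning
det-word D (F·E y x) = begin
  det D (mulM D (F (lift y)) (E (lift x)))          ≡⟨ det-mul D (F (lift y)) (E (lift x)) ⟩
  mulO D (det D (F (lift y))) (det D (E (lift x)))  ≡⟨ cong₂ (mulO D) (Order.det₂-lower D (lift y)) (Order.det₂-upper D (lift x)) ⟩
  mulO D 1O 1O                                      ≡⟨ Order.·-identityˡ D 1O ⟩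
  1O                                                ∎
  where open ≡-Reasoning

redM-E : ∀ x → redM (E (lift x)) ≡ E₂ x
redM-E x = mat₂-cong refl (red-lift x) refl refl

redM-F : ∀ y → redM (F (lift y)) ≡ F₂ y
redM-F y = mat₂-cong refl refl (red-lift y) refl

redM-word : ∀ D w → redM (word D w) ≡ word₂ (ω²mod2 D) w
redM-word D (E·F x y) = trans (redM-mul D (E (lift x)) (F (lift y)))
  (cong₂ (mulM₂ (ω²mod2 D)) (redM-E x) (redM-F y))
redM-word D (F·E y x) = trans (redM-mul D (F (lift y)) (E (lift x)))
  (cong₂ (mulM₂ (ω²mod2 D)) (redM-F y) (redM-E x))

-- 6. Counting cosets from representatives, checked modulo 2

det-quotient : ∀ D A γ → InSL2 D A → InSL2 D γ → InSL2 D (mulM D (invM A) γ)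
det-quotient D A γ detA≡1 detγ≡1 = begin
  det D (mulM D (invM A) γ)          ≡⟨ det-mul D (invM A) γ ⟩
  mulO D (det D (invM A)) (det D γ)  ≡⟨ cong₂ (mulO D) (trans (det-inv D A) detA≡1) detγ≡1 ⟩
  mulO D 1O 1O                       ≡⟨ Order.·-identityˡ D 1O ⟩
  1O                                 ∎
  where open ≡-Reasoning

redM-quotient : ∀ D A γ →
  redM (mulM D (invM A) γ) ≡ mulM₂ (ω²mod2 D) (adj₂ (redM A)) (redM γ)
redM-quotient D A γ = trans (redM-mul D (invM A) γ)
  (cong (λ B → mulM₂ (ω²mod2 D) B (redM γ)) (redM-inv A))

≈±⇒redM≡ : ∀ {g h} → g ≈± h → redM g ≡ redM h
≈±⇒redM≡ (inj₁ g≡h)  = cong redM g≡h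
≈±⇒redM≡ {h = h} (inj₂ g≡-h) = trans (cong redM g≡-h) (redM-neg h)

all-ℙ? : {P : Parity → Set} → (∀ x → Dec (P x)) → Dec (∀ x → P x)
all-ℙ? P? = map′ (λ (p₀ , p₁) → λ { 0ℙ → p₀ ; 1ℙ → p₁ }) (λ h → h 0ℙ , h 1ℙ)
                 (P? 0ℙ ×-dec P? 1ℙ)

all-F₂²? : {P : F₂² → Set} → (∀ x → Dec (P x)) → Dec (∀ x → P x)
all-F₂²? P? = map′ (λ h (x , y) → h x y) (λ h x y → h (x , y))
                   (all-ℙ? λ x → all-ℙ? λ y → P? (x , y))

all-Mat₂? : {P : Mat₂ → Set} → (∀ m → Dec (P m)) → Dec (∀ m → P m)
all-Mat₂? P? = map′ (λ h (mat₂ a b c d) → h a b c d) (λ h a b c d → h (mat₂ a b c d))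
  (all-F₂²? λ a → all-F₂²? λ b → all-F₂²? λ c → all-F₂²? λ d → P? (mat₂ a b c d))

Covers : F₂² → ∀ {n} → (Fin n → Word) → Set
Covers k ws = ∀ g → detM₂ k g ≡ 1₂ →
  ∃ λ i → IsM₂ (mulM₂ k (adj₂ (word₂ k (ws i))) g)

Separates : F₂² → ∀ {n} → (Fin n → Word) → Set
Separates k ws = ∀ i j → IsM₂ (mulM₂ k (adj₂ (word₂ k (ws i))) (word₂ k (ws j))) → i ≡ j

covers? : ∀ k {n} (ws : Fin n → Word) → Dec (Covers k ws)
covers? k ws = all-Mat₂? λ g → (detM₂ k g ≟₂ 1₂) →-dec
  any? λ i → isM₂? (mulM₂ k (adj₂ (word₂ k (ws i))) g)

separates? : ∀ k {n} (ws : Fin n → Word) → Dec (Separates k ws)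
separates? k ws = all? λ i → all? λ j →
  isM₂? (mulM₂ k (adj₂ (word₂ k (ws i))) (word₂ k (ws j))) →-dec (i Fin.≟ j)

-- Representatives that cover and separate modulo 2 exhibit [Γ_O : Γ] = n:
-- the coset of γ is detected by the class of r_i⁻¹γ modulo 2.
index-from-words : ∀ D {n} (ws : Fin n → Word) →
  Covers (ω²mod2 D) ws → Separates (ω²mod2 D) ws → IndexIs D n
index-from-words D {n} ws covers separates =
  r , (λ i → det-word D (ws i)) , cover , separate
  where
  k = ω²mod2 D
  r : Fin n → Mat
  r i = word D (ws i)
  red-quotient : ∀ i γ → redM (mulM D (invM (r i)) γ) ≡ mulM₂ k (adj₂ (word₂ k (ws i))) (redM γ)
  red-quotient i γ = trans (redM-quotient D (r i) γ)
    (cong (λ A → mulM₂ k (adj₂ A) (redM γ)) (redM-word D (ws i)))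
  cover : ∀ γ → InSL2 D γ → ∃ λ i → SameCoset D (r i) γ
  cover γ detγ≡1 with covers (redM γ) (trans (sym (redM-det D γ)) (cong red detγ≡1))
  ... | i , quotient∈M₂ = i , mulM D (invM (r i)) γ
      , (det-quotient D (r i) γ (det-word D (ws i)) detγ≡1
        , IsM₂⇒congruences (mulM D (invM (r i)) γ) (subst IsM₂ (sym (red-quotient i γ)) quotient∈M₂))
      , inj₁ refl , inj₁ refl
  separate : ∀ i j → SameCoset D (r i) (r j) → i ≡ j
  separate i j (m , m∈M , quotient≈±m , _) = separates i j (subst IsM₂ red-m (InM⇒IsM₂ D m m∈M))
    where
    red-m : redM m ≡ mulM₂ k (adj₂ (word₂ k (ws i))) (word₂ k (ws j))
    red-m = trans (sym (≈±⇒redM≡ quotient≈±m))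
      (trans (red-quotient i (r j)) (cong (mulM₂ k (adj₂ (word₂ k (ws i)))) (redM-word D (ws j))))

-- 7. The index in each residue class of ω² modulo 2

indexOf : F₂² → ℕ
indexOf (_  , 0ℙ) = 6
indexOf (0ℙ , 1ℙ) = 9
indexOf (1ℙ , 1ℙ) = 15

cosets : ∀ k → Fin (indexOf k) → Word
cosets (0ℙ , 0ℙ) = lookup
  (E·F 0₂ 0₂ ∷ E·F 0₂ 1₂ ∷ E·F 0₂ ω₂ ∷ E·F 0₂ 1+ω₂ ∷ E·F 1₂ 0₂ ∷ E·F 1₂ ω₂ ∷ [])
cosets (1ℙ , 0ℙ) = lookup
  (E·F 0₂ 0₂ ∷ E·F 0₂ 1₂ ∷ E·F 0₂ ω₂ ∷ E·F 0₂ 1+ω₂ ∷ E·F 1₂ 0₂ ∷ E·F 1₂ 1+ω₂ ∷ [])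
cosets (0ℙ , 1ℙ) = lookup
  (E·F 0₂ 0₂ ∷ E·F 0₂ 1₂ ∷ E·F 0₂ ω₂ ∷ E·F 0₂ 1+ω₂ ∷ E·F 1₂ 0₂ ∷ E·F 1₂ ω₂ ∷
   E·F 1₂ 1+ω₂ ∷ E·F ω₂ 0₂ ∷ E·F 1+ω₂ 0₂ ∷ [])
cosets (1ℙ , 1ℙ) = lookup
  (E·F 0₂ 0₂ ∷ E·F 0₂ 1₂ ∷ E·F 0₂ ω₂ ∷ E·F 0₂ 1+ω₂ ∷ E·F 1₂ 0₂ ∷ E·F 1₂ ω₂ ∷
   E·F 1₂ 1+ω₂ ∷ E·F ω₂ 0₂ ∷ E·F ω₂ ω₂ ∷ E·F ω₂ 1+ω₂ ∷ E·F 1+ω₂ 0₂ ∷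
   E·F 1+ω₂ ω₂ ∷ E·F 1+ω₂ 1+ω₂ ∷ F·E ω₂ ω₂ ∷ F·E 1+ω₂ 1+ω₂ ∷ [])

cosets-cover : ∀ k → True (covers? k (cosets k))
cosets-cover (0ℙ , 0ℙ) = tt
cosets-cover (1ℙ , 0ℙ) = tt
cosets-cover (0ℙ , 1ℙ) = tt
cosets-cover (1ℙ , 1ℙ) = tt

cosets-separate : ∀ k → True (separates? k (cosets k))
cosets-separate (0ℙ , 0ℙ) = tt
cosets-separate (1ℙ , 0ℙ) = tt
cosets-separate (0ℙ , 1ℙ) = tt
cosets-separate (1ℙ , 1ℙ) = tt

index-by-class : ∀ D → IndexIs D (indexOf (ω²mod2 D))
index-by-class D = index-from-words D (cosets k)
  (toWitness (cosets-cover k)) (toWitness (cosets-separate k))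
  where k = ω²mod2 D

-- 8. The character value χ(2) in each residue class

χ₂Of : F₂² → ℤ
χ₂Of (_  , 0ℙ) = + 0
χ₂Of (0ℙ , 1ℙ) = + 1
χ₂Of (1ℙ , 1ℙ) = - + 1

-- (Δ/2) for Δ = 1 + 4k is 1 or -1 according to the parity of k.
-- Residues modulo 8 are computed by a builtin, so kron2 (8 + n) and
-- kron2 n agree by evaluation.
kron2-one-mod-4 : ∀ k → kron2 (1 ℕ.+ k ℕ.* 4) ≡ χ₂Of (parity k , 1ℙ)
kron2-one-mod-4 zero          = refl
kron2-one-mod-4 (suc zero)    = refl
kron2-one-mod-4 (suc (suc k)) = kron2-one-mod-4 k

kron2-four-times : ∀ n → kron2 (n ℕ.* 4) ≡ + 0
kron2-four-times zero          = refl
kron2-four-times (suc zero)    = refl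
kron2-four-times (suc (suc n)) = kron2-four-times n

one-mod-4 : ∀ D → oneMod4 D ≡ true → D ≡ 1 ℕ.+ ((D ℕ.∸ 1) / 4) ℕ.* 4
one-mod-4 D e = trans D≡1+4k (cong (λ k → 1 ℕ.+ k ℕ.* 4) (sym k≡D/4))
  where
  D≡1+4k : D ≡ 1 ℕ.+ (D / 4) ℕ.* 4
  D≡1+4k = trans (m≡m%n+[m/n]*n D 4)
    (cong (ℕ._+ (D / 4) ℕ.* 4) (ℕP.≡ᵇ⇒≡ (D % 4) 1 (subst T (sym e) tt)))
  k≡D/4 : (D ℕ.∸ 1) / 4 ≡ D / 4
  k≡D/4 = trans (cong (λ z → (z ℕ.∸ 1) / 4) D≡1+4k) (m*n/n≡m (D / 4) 4)

χ2-by-class : ∀ D → χ2 D ≡ χ₂Of (ω²mod2 D)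
χ2-by-class D with oneMod4 D in e
... | true  = trans (cong kron2 (one-mod-4 D e)) (kron2-one-mod-4 ((D ℕ.∸ 1) / 4))
... | false = trans (cong kron2 (ℕP.*-comm 4 D)) (kron2-four-times D)

-- 9. The theorem

index-formula : ∀ k → + indexOf k ≡ + 6 - + 3 * χ₂Of k + + 6 * (χ₂Of k * χ₂Of k)
index-formula (_  , 0ℙ) = refl
index-formula (0ℙ , 1ℙ) = refl
index-formula (1ℙ , 1ℙ) = refl

corollary1 : (D : ℕ) → 1 < D → SquareFree D →
    Σ ℕ λ N → IndexIs D N × (+ N ≡ + 6 - + 3 * χ2 D + + 6 * χ4 D)
corollary1 D _ _ = indexOf k , index-by-class D ,
  subst (λ χ → + indexOf k ≡ + 6 - + 3 * χ + + 6 * (χ * χ)) (sym (χ2-by-class D)) (index-formula k)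
  where k = ω²mod2 D
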